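{- Let $S=\{x_1,\dots,x_n\}\subseteq\Pi^d$, let $x^*$ be an optimal Ulam 1-median of $S$, $OPT=\sum_i\Delta(x_i,x^*)$, let $I_i$ be the set of symbols of $[d]$ not in a fixed longest common subsequence of $x_i$ and $x^*$, and assume $|I_1|\le\dots\le|I_n|$. Let $\alpha\in(0,1/3]$, $c_3\in(0,1]$ and $\varepsilon>0$ be constants. Let $s$ be the least index with $|I_s|>(1-\alpha)\frac{OPT}{n}$ and $t$ the least index with $|I_t|>(1+\alpha)\frac{OPT}{n}$, and set $\bar{F}=\{x_s,\dots,x_{t-1}\}$. For $x_j\in\bar{F}$ let $B(x_j,\varepsilon)=\{x_i\in\bar{F}:|I_i\cap I_j|>\varepsilon|I_j|\}$, and let $G$ be the set of $x_j\in\bar{F}$ with $OPT_{B(x_j,\varepsilon)}\ge c_3\cdot OPT_{\bar{F}}$. Then for every $x_j\in G$, $$\sum_{x_i\in B(x_j,\varepsilon)}\Delta(x_i,x_j)\le\left(2-\varepsilon\left(1+3\alpha-\frac{3\alpha}{\varepsilon}\right)\right)\cdot OPT_{B(x_j,\varepsilon)}.$$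
   Context: $\Pi^d$ is the set of permutations of $[d]$; $\Delta(x,y)=d-\mathrm{lcs}(x,y)$ is the Ulam distance, with $\mathrm{lcs}$ the length of a longest common subsequence; an optimal 1-median $x^*$ minimizes $\sum_{s\in S}\Delta(s,\cdot)$ over $\Pi^d$. For a subset $A\subseteq S$, $OPT_A=\sum_{x\in A}\Delta(x,x^*)$.
   Formalization: The constants α, c₃ and ε are taken to be rational numbers. -}

module Defs where

open import Data.Bool using (Bool; true; false; if_then_else_; _∧_; not)
open import Data.Nat using (ℕ; zero; suc; _⊔_; _∸_; _≤ᵇ_; _<ᵇ_)
open import Data.Integer using (+_)
open import Data.Fin using (Fin; toℕ)
import Data.Fin.Properties as FinP
open import Data.Fin.Subset using (Subset; _∩_; ∣_∣)
open import Data.Vec using (tabulate)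
open import Data.List using (List; []; _∷_; _++_; map; filter; length; foldr; allFin)
open import Data.Nat.ListAction using (sum)
open import Data.Bool.ListAction using (any)
open import Data.List.Relation.Binary.Permutation.Propositional using (_↭_)
open import Data.Product using (_×_; Σ)
open import Data.Rational using (ℚ; _/_; _<_; 0ℚ; _÷_; >-nonZero)
open import Relation.Nullary using (¬_; does)
import Data.List.Relation.Binary.Sublist.DecPropositional as SubDec
open import Relation.Binary.PropositionalEquality using (_≡_)

record Perm (d : ℕ) : Set where
  constructor perm
  field
    word   : List (Fin d)
    isPerm : word ↭ allFin d
open Perm public

module _ {d : ℕ} where
  open SubDec (FinP._≟_ {d}) public using (_⊆_; _⊆?_)

subseqs : {A : Set} → List A → List (List A)
subseqs []       = [] ∷ []
subseqs (a ∷ as) = map (a ∷_) (subseqs as) ++ subseqs as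

maximum : List ℕ → ℕ
maximum = foldr _⊔_ 0

lcs : {d : ℕ} → List (Fin d) → List (Fin d) → ℕ
lcs u v = maximum (map length (filter (λ L → L ⊆? v) (subseqs u)))

Δ : {d : ℕ} → Perm d → Perm d → ℕ
Δ {d} x y = d ∸ lcs (word x) (word y)

IsLCS : {d : ℕ} → List (Fin d) → Perm d → Perm d → Set
IsLCS L x y = (L ⊆ word x) × (L ⊆ word y) × (length L ≡ lcs (word x) (word y))

notIn : {d : ℕ} → List (Fin d) → Subset d
notIn L = tabulate (λ k → not (any (λ l → does (k FinP.≟ l)) L))

sumOver : {n : ℕ} → (Fin n → Bool) → (Fin n → ℕ) → ℕ
sumOver {n} A f = sum (map (λ i → if A i then f i else 0) (allFin n))

⟦_⟧ : ℕ → ℚ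
⟦ k ⟧ = (+ k) / 1

-- k is the least index (0-based) in Fin n satisfying P, or k = n if there is none
LeastOrEnd : (n : ℕ) → (Fin n → Set) → ℕ → Set
LeastOrEnd n P k =
  (k Data.Nat.≤ n) ×
  ((i : Fin n) → toℕ i Data.Nat.< k → ¬ P i) ×
  ((i : Fin n) → toℕ i ≡ k → P i)

_<ᵠ_ : ℚ → ℚ → Bool
p <ᵠ q = does (p Data.Rational.<? q)

divPos : (p q : ℚ) → 0ℚ < q → ℚ
divPos p q q>0 = _÷_ p q {{>-nonZero q>0}}

-- Let Sᵢ be the set of symbols of Lᵢ, so that Iᵢ is its complement. For i and j in the window F̄, the
-- symbols of Sᵢ ∩ Sⱼ occur in Lᵢ and Lⱼ in the order they have in x*, so they form a common subsequence
-- of xᵢ and xⱼ; hence Δ(xᵢ,xⱼ) ≤ |Iᵢ ∪ Iⱼ| = |Iᵢ| + |Iⱼ| − |Iᵢ ∩ Iⱼ|, while |Iᵢ| = Δ(xᵢ,x*). If xᵢ lies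
-- in B(xⱼ,ε) the overlap exceeds ε|Iⱼ|, and as both |Iᵢ| and |Iⱼ| lie between (1 − α)·OPT/n and
-- (1 + α)·OPT/n, we get |Iⱼ| ≤ (1 + α)/(1 − α)·|Iᵢ| ≤ (1 + 3α)|Iᵢ| for α ≤ 1/3. Therefore
-- Δ(xᵢ,xⱼ) ≤ (1 + (1 − ε)(1 + 3α))·Δ(xᵢ,x*), and 1 + (1 − ε)(1 + 3α) = 2 − ε(1 + 3α − 3α/ε);
-- summing over B(xⱼ,ε) gives the claim. For ε > 1 the ball B(xⱼ,ε) is empty.
module Submission where

module Ulam where
  open import Defs hiding (_⊆_)
  open import Algebra.Lattice.Properties.BooleanAlgebra using (deMorgan₁)
  open import Data.Bool using (true; not; T)
  open import Data.Bool.Properties using (T-≡)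
  open import Data.Bool.ListAction using (any)
  open import Data.Nat using (ℕ; zero; suc; _+_; _∸_; _≤_)
  open import Data.Nat.Properties using (+-suc; m≤m⊔n; m≤n⇒m≤o⊔n; ∸-monoʳ-≤; +-monoˡ-≤; module ≤-Reasoning)
  open import Data.Fin using (Fin; zero; suc)
  open import Data.Fin.Properties using (_≟_)
  open import Data.Fin.Subset using (Subset; inside; outside; ⁅_⁆; ∁; _∪_; _∩_; ∣_∣)
    renaming (_∈_ to _∈ₛ_; _∉_ to _∉ₛ_)
  open import Data.Fin.Subset.Properties
    using (⊆-antisym; ∉⊥; x∈⁅x⁆; x∈⁅y⁆⇒x≡y; x∈p∪q⁺; x∈p∪q⁻; x∈p∩q⁺; x∈p∩q⁻; ∣⊥∣≡0; ∪-identityˡ;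
           ∣∁p∣≡n∸∣p∣; ∪-∩-booleanAlgebra)
  open import Data.Vec using ([]; _∷_; tabulate; lookup; here; there)
  open import Data.Vec.Properties using (tabulate-∘; lookup∘tabulate; []=⇒lookup; lookup⇒[]=)
  open import Data.List using (List; []; _∷_; length; map; filter)
  open import Data.List.Membership.Propositional using (_∈_)
  open import Data.List.Membership.Propositional.Properties
    using (∈-map⁺; ∈-++⁺ˡ; ∈-++⁺ʳ; ∈-filter⁺; ∈-filter⁻)
  import Data.List.Membership.DecPropositional as DecMembership
  open import Data.List.Relation.Unary.All using (All)
  import Data.List.Relation.Unary.All as All
  open import Data.List.Relation.Unary.Any using (here; there)
  import Data.List.Relation.Unary.Any as Any
  open import Data.List.Relation.Unary.Any.Properties using (any⁺; any⁻)
  open import Data.List.Relation.Unary.Unique.Propositional using (Unique; []; _∷_)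
  open import Data.List.Relation.Unary.Unique.Propositional.Properties
    using (allFin⁺; filter⁺; Unique[x∷xs]⇒x∉xs)
  open import Data.List.Relation.Binary.Sublist.Propositional using (_⊆_; []; _∷_; _∷ʳ_; ⊆-trans)
  import Data.List.Relation.Binary.Sublist.Propositional as Sublist
  open import Data.List.Relation.Binary.Sublist.Propositional.Properties using (All-resp-⊆; filter-⊆)
  open import Data.List.Relation.Binary.Permutation.Propositional using (↭-sym; ↭⇒↭ₛ)
  open import Data.List.Relation.Binary.Permutation.Setoid.Properties using (Unique-resp-↭)
  open import Data.Sum using (inj₁; inj₂; [_,_]′)
  open import Data.Product using (_,_; proj₂)
  open import Function using (_∘_; Equivalence)
  open import Relation.Nullary using (does; contradiction)
  open import Relation.Nullary.Decidable using (yes; no; dec-true)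
  open import Relation.Binary.PropositionalEquality hiding ([_])

  ∣p∪q∣+∣p∩q∣≡∣p∣+∣q∣ : ∀ {n} (p q : Subset n) → ∣ p ∪ q ∣ + ∣ p ∩ q ∣ ≡ ∣ p ∣ + ∣ q ∣
  ∣p∪q∣+∣p∩q∣≡∣p∣+∣q∣ []            []            = refl
  ∣p∪q∣+∣p∩q∣≡∣p∣+∣q∣ (inside  ∷ p) (inside  ∷ q) =
    cong suc (trans (+-suc _ _) (trans (cong suc (∣p∪q∣+∣p∩q∣≡∣p∣+∣q∣ p q)) (sym (+-suc _ _))))
  ∣p∪q∣+∣p∩q∣≡∣p∣+∣q∣ (inside  ∷ p) (outside ∷ q) = cong suc (∣p∪q∣+∣p∩q∣≡∣p∣+∣q∣ p q)
  ∣p∪q∣+∣p∩q∣≡∣p∣+∣q∣ (outside ∷ p) (inside  ∷ q) =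
    trans (cong suc (∣p∪q∣+∣p∩q∣≡∣p∣+∣q∣ p q)) (sym (+-suc _ _))
  ∣p∪q∣+∣p∩q∣≡∣p∣+∣q∣ (outside ∷ p) (outside ∷ q) = ∣p∪q∣+∣p∩q∣≡∣p∣+∣q∣ p q

  x∉p⇒∣⁅x⁆∪p∣≡1+∣p∣ : ∀ {n} {x : Fin n} {p : Subset n} → x ∉ₛ p → ∣ ⁅ x ⁆ ∪ p ∣ ≡ suc ∣ p ∣
  x∉p⇒∣⁅x⁆∪p∣≡1+∣p∣ {x = zero}  {outside ∷ p} _   = cong (suc ∘ ∣_∣) (∪-identityˡ p)
  x∉p⇒∣⁅x⁆∪p∣≡1+∣p∣ {x = zero}  {inside  ∷ p} x∉p = contradiction here x∉p
  x∉p⇒∣⁅x⁆∪p∣≡1+∣p∣ {x = suc x} {outside ∷ p} x∉p = x∉p⇒∣⁅x⁆∪p∣≡1+∣p∣ (x∉p ∘ there)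
  x∉p⇒∣⁅x⁆∪p∣≡1+∣p∣ {x = suc x} {inside  ∷ p} x∉p = cong suc (x∉p⇒∣⁅x⁆∪p∣≡1+∣p∣ (x∉p ∘ there))

  module _ {A : Set} where

    Unique-resp-⊇ : ∀ {xs ys : List A} → xs ⊆ ys → Unique ys → Unique xs
    Unique-resp-⊇ []         []         = []
    Unique-resp-⊇ (_ ∷ʳ τ)   (_ ∷ u)    = Unique-resp-⊇ τ u
    Unique-resp-⊇ (refl ∷ τ) (y∉ys ∷ u) = All-resp-⊆ τ y∉ys ∷ Unique-resp-⊇ τ u

    private
      ≢-head : ∀ {w x : A} {ws} → All (w ≢_) ws → x ∈ ws → x ≢ w
      ≢-head w∉ws x∈ws x≡w = All.lookup w∉ws x∈ws (sym x≡w)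

    ⊆-by-elements : ∀ {ws xs ys : List A} → Unique ws → xs ⊆ ws → ys ⊆ ws →
                    (∀ {x} → x ∈ xs → x ∈ ys) → xs ⊆ ys
    ⊆-by-elements []         []          []          _     = []
    ⊆-by-elements (_ ∷ u)    (w ∷ʳ τx)   (.w ∷ʳ τy)  xs⊆ys = ⊆-by-elements u τx τy xs⊆ys
    ⊆-by-elements (w∉ws ∷ u) (w ∷ʳ τx)   (refl ∷ τy) xs⊆ys =
      w ∷ʳ ⊆-by-elements u τx τy (λ x∈xs →
        Any.tail (≢-head w∉ws (Sublist.lookup τx x∈xs)) (xs⊆ys x∈xs))
    ⊆-by-elements (w∉ws ∷ u) (refl ∷ τx) (w ∷ʳ τy)   xs⊆ys =
      contradiction refl (≢-head w∉ws (Sublist.lookup τy (xs⊆ys (here refl))))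
    ⊆-by-elements (w∉ws ∷ u) (refl ∷ τx) (refl ∷ τy) xs⊆ys =
      refl ∷ ⊆-by-elements u τx τy (λ x∈xs →
        Any.tail (≢-head w∉ws (Sublist.lookup τx x∈xs)) (xs⊆ys (there x∈xs)))

    ⊆⇒∈-subseqs : ∀ {xs ys : List A} → xs ⊆ ys → xs ∈ subseqs ys
    ⊆⇒∈-subseqs []                     = here refl
    ⊆⇒∈-subseqs {ys = y ∷ ys} (y ∷ʳ τ) = ∈-++⁺ʳ (map (y ∷_) (subseqs ys)) (⊆⇒∈-subseqs τ)
    ⊆⇒∈-subseqs (refl ∷ τ)             = ∈-++⁺ˡ (∈-map⁺ _ (⊆⇒∈-subseqs τ))

  ≤-maximum : ∀ {m ms} → m ∈ ms → m ≤ maximum ms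
  ≤-maximum (here refl)                = m≤m⊔n _ _
  ≤-maximum {ms = m′ ∷ _} (there m∈ms) = m≤n⇒m≤o⊔n m′ (≤-maximum m∈ms)

  module _ {d : ℕ} where

    elems : List (Fin d) → Subset d
    elems L = tabulate (λ k → any (λ l → does (k ≟ l)) L)

    private
      does-≟⇒≡ : ∀ {x y : Fin d} → T (does (x ≟ y)) → x ≡ y
      does-≟⇒≡ {x} {y} _ with x ≟ y
      does-≟⇒≡ _  | yes x≡y = x≡y
      does-≟⇒≡ () | no _

      ≡⇒does-≟ : ∀ {x y : Fin d} → x ≡ y → T (does (x ≟ y))
      ≡⇒does-≟ {x} {y} x≡y = Equivalence.from T-≡ (dec-true (x ≟ y) x≡y)

    notIn≡∁elems : (L : List (Fin d)) → notIn L ≡ ∁ (elems L)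
    notIn≡∁elems L = tabulate-∘ not (λ k → any (λ l → does (k ≟ l)) L)

    ∈-elems⁺ : ∀ {x L} → x ∈ L → x ∈ₛ elems L
    ∈-elems⁺ {x} {L} x∈L = lookup⇒[]= x (elems L) (begin
      lookup (elems L) x          ≡⟨ lookup∘tabulate _ x ⟩
      any (λ l → does (x ≟ l)) L  ≡⟨ Equivalence.to T-≡ (any⁺ _ (Any.map ≡⇒does-≟ x∈L)) ⟩
      true                        ∎)
      where open ≡-Reasoning

    ∈-elems⁻ : ∀ {x L} → x ∈ₛ elems L → x ∈ L
    ∈-elems⁻ {x} {L} x∈ₛL = Any.map does-≟⇒≡ (any⁻ _ L (Equivalence.from T-≡
      (trans (sym (lookup∘tabulate _ x)) ([]=⇒lookup x∈ₛL))))

    elems-unique : ∀ {p L} → (∀ {x} → x ∈ₛ p → x ∈ L) → (∀ {x} → x ∈ L → x ∈ₛ p) → elems L ≡ p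
    elems-unique p⊆L L⊆p = ⊆-antisym (L⊆p ∘ ∈-elems⁻) (∈-elems⁺ ∘ p⊆L)

    ∣elems∣≡length : ∀ {L} → Unique L → ∣ elems L ∣ ≡ length L
    ∣elems∣≡length {[]} [] =
      trans (cong ∣_∣ (elems-unique {L = []} (λ x∈∅ → contradiction x∈∅ ∉⊥) λ ())) (∣⊥∣≡0 d)
    ∣elems∣≡length {a ∷ L} a∷L-Unique@(_ ∷ L-Unique) = begin
      ∣ elems (a ∷ L) ∣    ≡⟨ cong ∣_∣ (elems-unique ∈⁅a⁆∪elems⇒∈ ∈⇒∈⁅a⁆∪elems) ⟩
      ∣ ⁅ a ⁆ ∪ elems L ∣  ≡⟨ x∉p⇒∣⁅x⁆∪p∣≡1+∣p∣ (Unique[x∷xs]⇒x∉xs a∷L-Unique ∘ ∈-elems⁻) ⟩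
      suc ∣ elems L ∣      ≡⟨ cong suc (∣elems∣≡length L-Unique) ⟩
      suc (length L)       ∎
      where
      open ≡-Reasoning
      ∈⁅a⁆∪elems⇒∈ : ∀ {x} → x ∈ₛ ⁅ a ⁆ ∪ elems L → x ∈ a ∷ L
      ∈⁅a⁆∪elems⇒∈ h = [ here ∘ x∈⁅y⁆⇒x≡y a , there ∘ ∈-elems⁻ {L = L} ]′ (x∈p∪q⁻ ⁅ a ⁆ (elems L) h)
      ∈⇒∈⁅a⁆∪elems : ∀ {x} → x ∈ a ∷ L → x ∈ₛ ⁅ a ⁆ ∪ elems L
      ∈⇒∈⁅a⁆∪elems (here refl) = x∈p∪q⁺ (inj₁ (x∈⁅x⁆ a))
      ∈⇒∈⁅a⁆∪elems (there x∈L) = x∈p∪q⁺ (inj₂ (∈-elems⁺ x∈L))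

    ≤-lcs : ∀ {C u v : List (Fin d)} → C ⊆ u → C ⊆ v → length C ≤ lcs u v
    ≤-lcs {v = v} C⊆u C⊆v = ≤-maximum (∈-map⁺ length (∈-filter⁺ (_⊆? v) (⊆⇒∈-subseqs C⊆u) C⊆v))

    word-Unique : (p : Perm d) → Unique (word p)
    word-Unique p = Unique-resp-↭ (setoid (Fin d)) (↭⇒↭ₛ (↭-sym (isPerm p))) (allFin⁺ d)

    open DecMembership (_≟_ {d}) using (_∈?_)

    ∣notIn∣≡Δ : ∀ {L} {x y : Perm d} → IsLCS L x y → ∣ notIn L ∣ ≡ Δ x y
    ∣notIn∣≡Δ {L} {x} {y} (_ , L⊆y , ∣L∣≡lcs) = begin
      ∣ notIn L ∣      ≡⟨ cong ∣_∣ (notIn≡∁elems L) ⟩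
      ∣ ∁ (elems L) ∣  ≡⟨ ∣∁p∣≡n∸∣p∣ (elems L) ⟩
      d ∸ ∣ elems L ∣  ≡⟨ cong (d ∸_) (∣elems∣≡length (Unique-resp-⊇ L⊆y (word-Unique y))) ⟩
      d ∸ length L     ≡⟨ cong (d ∸_) ∣L∣≡lcs ⟩
      Δ x y            ∎
      where open ≡-Reasoning

    Δ≤∣notIn∪notIn∣ : ∀ {Li Lj} {xi xj z : Perm d} → IsLCS Li xi z → IsLCS Lj xj z →
                      Δ xi xj ≤ ∣ notIn Li ∪ notIn Lj ∣
    Δ≤∣notIn∪notIn∣ {Li} {Lj} {xi} {xj} {z} (Li⊆xi , Li⊆z , _) (Lj⊆xj , Lj⊆z , _) = begin
      Δ xi xj                          ≤⟨ ∸-monoʳ-≤ d (≤-lcs C⊆xi C⊆xj) ⟩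
      d ∸ length C                     ≡⟨ cong (d ∸_) (∣elems∣≡length C-Unique) ⟨
      d ∸ ∣ elems C ∣                  ≡⟨ cong (λ p → d ∸ ∣ p ∣) elems-C ⟩
      d ∸ ∣ elems Li ∩ elems Lj ∣      ≡⟨ ∣∁p∣≡n∸∣p∣ (elems Li ∩ elems Lj) ⟨
      ∣ ∁ (elems Li ∩ elems Lj) ∣      ≡⟨ cong ∣_∣ (deMorgan₁ (∪-∩-booleanAlgebra d) (elems Li) (elems Lj)) ⟩
      ∣ ∁ (elems Li) ∪ ∁ (elems Lj) ∣  ≡⟨ cong₂ (λ p q → ∣ p ∪ q ∣) (notIn≡∁elems Li) (notIn≡∁elems Lj) ⟨
      ∣ notIn Li ∪ notIn Lj ∣          ∎
      where
      open ≤-Reasoning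
      C : List (Fin d)
      C = filter (_∈? Lj) Li
      C⊆Li : C ⊆ Li
      C⊆Li = filter-⊆ (_∈? Lj) Li
      C⊆xi : C ⊆ word xi
      C⊆xi = ⊆-trans C⊆Li Li⊆xi
      -- C and Lj are both sublists of the duplicate-free word of z, and every symbol of C is in Lj.
      C⊆xj : C ⊆ word xj
      C⊆xj = ⊆-trans (⊆-by-elements (word-Unique z) (⊆-trans C⊆Li Li⊆z) Lj⊆z
                        (proj₂ ∘ ∈-filter⁻ (_∈? Lj) {xs = Li})) Lj⊆xj
      C-Unique : Unique C
      C-Unique = filter⁺ (_∈? Lj) (Unique-resp-⊇ Li⊆z (word-Unique z))
      elems-C : elems C ≡ elems Li ∩ elems Lj
      elems-C = elems-unique
        (λ x∈Si∩Sj → let (x∈Si , x∈Sj) = x∈p∩q⁻ (elems Li) (elems Lj) x∈Si∩Sj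
                     in ∈-filter⁺ (_∈? Lj) (∈-elems⁻ {L = Li} x∈Si) (∈-elems⁻ {L = Lj} x∈Sj))
        (λ x∈C → let (x∈Li , x∈Lj) = ∈-filter⁻ (_∈? Lj) {xs = Li} x∈C
                 in x∈p∩q⁺ (∈-elems⁺ x∈Li , ∈-elems⁺ x∈Lj))

    Δ+∣notIn∩notIn∣≤∣notIn∣+∣notIn∣ : ∀ {Li Lj} {xi xj z : Perm d} → IsLCS Li xi z → IsLCS Lj xj z →
      Δ xi xj + ∣ notIn Li ∩ notIn Lj ∣ ≤ ∣ notIn Li ∣ + ∣ notIn Lj ∣
    Δ+∣notIn∩notIn∣≤∣notIn∣+∣notIn∣ {Li} {Lj} {xi} {xj} {z} lcsi lcsj = begin
      Δ xi xj + ∣ notIn Li ∩ notIn Lj ∣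
        ≤⟨ +-monoˡ-≤ _ (Δ≤∣notIn∪notIn∣ {Li} {Lj} {xi} {xj} {z} lcsi lcsj) ⟩
      ∣ notIn Li ∪ notIn Lj ∣ + ∣ notIn Li ∩ notIn Lj ∣
        ≡⟨ ∣p∪q∣+∣p∩q∣≡∣p∣+∣q∣ (notIn Li) (notIn Lj) ⟩
      ∣ notIn Li ∣ + ∣ notIn Lj ∣                        ∎
      where open ≤-Reasoning

module RationalBounds where
  open import Defs using (⟦_⟧; sumOver; _<ᵠ_)
  open import Data.Bool using (Bool; true; false; if_then_else_)
  open import Data.Nat using (ℕ; z≤n) renaming (_+_ to _+ℕ_; _≤_ to _≤ℕ_)
  open import Data.Nat.Coprimality using (1-coprimeTo) renaming (sym to coprime-sym)
  open import Data.Nat.ListAction using (sum)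
  open import Data.Integer using (+_)
  import Data.Integer as ℤ
  import Data.Integer.Properties as ℤ
  open import Data.Fin using (Fin)
  open import Data.List using ([]; _∷_; map; allFin)
  open import Data.Rational
  open import Data.Rational.Properties
  import Data.Rational.Unnormalised as ℚᵘ
  import Data.Rational.Unnormalised.Properties as ℚᵘ
  open import Data.Rational.Solver using (module +-*-Solver)
  open +-*-Solver using (solve; _:+_; _:*_; _:-_; con; _:=_)
  open import Relation.Nullary using (proof)
  open import Relation.Nullary.Reflects using (Reflects; invert)
  open import Relation.Binary.PropositionalEquality

  <ᵠ⇒< : ∀ {p q} → p <ᵠ q ≡ true → p < q
  <ᵠ⇒< {p} {q} p<ᵠq = invert (subst (Reflects (p < q)) p<ᵠq (proof (p <? q)))

  ⟦⟧≡mkℚ : ∀ k → ⟦ k ⟧ ≡ mkℚ (+ k) 0 (coprime-sym (1-coprimeTo k))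
  ⟦⟧≡mkℚ k = normalize-coprime (coprime-sym (1-coprimeTo k))

  ⟦⟧-homo-+ : ∀ a b → ⟦ a +ℕ b ⟧ ≡ ⟦ a ⟧ + ⟦ b ⟧
  ⟦⟧-homo-+ a b = toℚᵘ-injective (ℚᵘ.≃-trans unnormalised (ℚᵘ.≃-sym (toℚᵘ-homo-+ ⟦ a ⟧ ⟦ b ⟧)))
    where
    unnormalised : toℚᵘ ⟦ a +ℕ b ⟧ ℚᵘ.≃ toℚᵘ ⟦ a ⟧ ℚᵘ.+ toℚᵘ ⟦ b ⟧
    unnormalised rewrite ⟦⟧≡mkℚ (a +ℕ b) | ⟦⟧≡mkℚ a | ⟦⟧≡mkℚ b =
      ℚᵘ.*≡* (cong (ℤ._* + 1) (trans (sym (ℤ.pos-+ a b))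
        (sym (cong₂ ℤ._+_ (ℤ.*-identityʳ (+ a)) (ℤ.*-identityʳ (+ b))))))

  ⟦⟧-mono-≤ : ∀ {a b} → a ≤ℕ b → ⟦ a ⟧ ≤ ⟦ b ⟧
  ⟦⟧-mono-≤ {a} {b} a≤b rewrite ⟦⟧≡mkℚ a | ⟦⟧≡mkℚ b =
    *≤* (subst₂ ℤ._≤_ (sym (ℤ.*-identityʳ (+ a))) (sym (ℤ.*-identityʳ (+ b))) (ℤ.+≤+ a≤b))

  ⟦⟧-nonNeg : ∀ a → 0ℚ ≤ ⟦ a ⟧
  ⟦⟧-nonNeg a = ⟦⟧-mono-≤ {0} {a} z≤n

  module _ {X : Set} (K : ℚ) (f g : X → ℕ) (f≤Kg : ∀ x → ⟦ f x ⟧ ≤ K * ⟦ g x ⟧) where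

    sum-≤-scaled : ∀ xs → ⟦ sum (map f xs) ⟧ ≤ K * ⟦ sum (map g xs) ⟧
    sum-≤-scaled []       = ≤-reflexive (sym (*-zeroʳ K))
    sum-≤-scaled (x ∷ xs) = begin
      ⟦ f x +ℕ sum (map f xs) ⟧             ≡⟨ ⟦⟧-homo-+ (f x) _ ⟩
      ⟦ f x ⟧ + ⟦ sum (map f xs) ⟧          ≤⟨ +-mono-≤ (f≤Kg x) (sum-≤-scaled xs) ⟩
      K * ⟦ g x ⟧ + K * ⟦ sum (map g xs) ⟧  ≡⟨ *-distribˡ-+ K _ _ ⟨
      K * (⟦ g x ⟧ + ⟦ sum (map g xs) ⟧)    ≡⟨ cong (K *_) (⟦⟧-homo-+ (g x) _) ⟨
      K * ⟦ g x +ℕ sum (map g xs) ⟧         ∎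
      where open ≤-Reasoning

  sumOver-≤-scaled : ∀ {n} (K : ℚ) (A : Fin n → Bool) (f g : Fin n → ℕ) →
                     (∀ i → A i ≡ true → ⟦ f i ⟧ ≤ K * ⟦ g i ⟧) →
                     ⟦ sumOver A f ⟧ ≤ K * ⟦ sumOver A g ⟧
  sumOver-≤-scaled {n} K A f g f≤Kg = sum-≤-scaled K _ _ on-A (allFin n)
    where
    on-A : ∀ i → ⟦ if A i then f i else 0 ⟧ ≤ K * ⟦ if A i then g i else 0 ⟧
    on-A i with A i in i∈A
    ... | true  = f≤Kg i i∈A
    ... | false = ≤-reflexive (sym (*-zeroʳ K))

  p≤q⇒0≤q-p : ∀ {p q} → p ≤ q → 0ℚ ≤ q - p
  p≤q⇒0≤q-p {p} {q} p≤q = subst (_≤ q - p) (+-inverseʳ p) (+-monoˡ-≤ (- p) p≤q)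

  p≤p+q : ∀ {p q} → 0ℚ ≤ q → p ≤ p + q
  p≤p+q {p} {q} 0≤q = subst (_≤ p + q) (+-identityʳ p) (+-monoʳ-≤ p 0≤q)

  0≤p*q : ∀ {p q} → 0ℚ ≤ p → 0ℚ ≤ q → 0ℚ ≤ p * q
  0≤p*q {p} {q} 0≤p 0≤q = subst (_≤ p * q) (*-zeroʳ p) (*-monoˡ-≤-nonNeg p {{nonNegative 0≤p}} 0≤q)

  p*[q÷p]≡q : ∀ p q .{{_ : NonZero p}} → p * (q ÷ p) ≡ q
  p*[q÷p]≡q p q = begin
    p * (q * 1/ p)  ≡⟨ solve 3 (λ p q r → p :* (q :* r) := q :* (p :* r)) refl p q (1/ p) ⟩
    q * (p * 1/ p)  ≡⟨ cong (q *_) (*-inverseʳ p) ⟩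
    q * 1ℚ          ≡⟨ *-identityʳ q ⟩
    q               ∎
    where open ≡-Reasoning

  2-ε[1+t-q]≡1+[1-ε][1+t] : ∀ ε q t → ε * q ≡ t → ⟦ 2 ⟧ - ε * (1ℚ + t - q) ≡ 1ℚ + (1ℚ - ε) * (1ℚ + t)
  2-ε[1+t-q]≡1+[1-ε][1+t] ε q t εq≡t = begin
    ⟦ 2 ⟧ - ε * (1ℚ + t - q)  ≡⟨ solve 3 (λ ε q t → con ⟦ 2 ⟧ :- ε :* (con 1ℚ :+ t :- q)
                                 := (con 1ℚ :+ (con 1ℚ :- ε) :* (con 1ℚ :+ t)) :+ (ε :* q :- t)) refl ε q t ⟩
    K + (ε * q - t)           ≡⟨ cong (λ εq → K + (εq - t)) εq≡t ⟩
    K + (t - t)               ≡⟨ cong (_+_ K) (+-inverseʳ t) ⟩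
    K + 0ℚ                    ≡⟨ +-identityʳ K ⟩
    K                         ∎
    where
    open ≡-Reasoning
    K = 1ℚ + (1ℚ - ε) * (1ℚ + t)

  1+α≤[1+3α][1-α] : ∀ {α} → 0ℚ ≤ α → α ≤ + 1 / 3 → 1ℚ + α ≤ (1ℚ + ⟦ 3 ⟧ * α) * (1ℚ - α)
  1+α≤[1+3α][1-α] {α} 0≤α α≤⅓ = begin
    1ℚ + α                           ≤⟨ p≤p+q (0≤p*q 0≤α (p≤q⇒0≤q-p (*-monoˡ-≤-nonNeg ⟦ 3 ⟧ α≤⅓))) ⟩
    (1ℚ + α) + α * (1ℚ - ⟦ 3 ⟧ * α)  ≡⟨ solve 1 (λ α → (con 1ℚ :+ α) :+ α :* (con 1ℚ :- con ⟦ 3 ⟧ :* α)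
                                          := (con 1ℚ :+ con ⟦ 3 ⟧ :* α) :* (con 1ℚ :- α)) refl α ⟩
    (1ℚ + ⟦ 3 ⟧ * α) * (1ℚ - α)      ∎
    where open ≤-Reasoning

  band-ratio : ∀ {α M a b} → 0ℚ ≤ α → α ≤ + 1 / 3 → 0ℚ ≤ M →
               (1ℚ - α) * M ≤ a → b ≤ (1ℚ + α) * M → b ≤ (1ℚ + ⟦ 3 ⟧ * α) * a
  band-ratio {α} {M} {a} {b} 0≤α α≤⅓ 0≤M lower upper = begin
    b                                  ≤⟨ upper ⟩
    (1ℚ + α) * M                       ≤⟨ *-monoʳ-≤-nonNeg M {{nonNegative 0≤M}} (1+α≤[1+3α][1-α] 0≤α α≤⅓) ⟩
    (1ℚ + ⟦ 3 ⟧ * α) * (1ℚ - α) * M    ≡⟨ *-assoc (1ℚ + ⟦ 3 ⟧ * α) (1ℚ - α) M ⟩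
    (1ℚ + ⟦ 3 ⟧ * α) * ((1ℚ - α) * M)  ≤⟨ *-monoˡ-≤-nonNeg (1ℚ + ⟦ 3 ⟧ * α) {{nonNegative 0≤1+3α}} lower ⟩
    (1ℚ + ⟦ 3 ⟧ * α) * a               ∎
    where
    open ≤-Reasoning
    0≤1+3α : 0ℚ ≤ 1ℚ + ⟦ 3 ⟧ * α
    0≤1+3α = +-mono-≤ (nonNegative⁻¹ 1ℚ) (0≤p*q (nonNegative⁻¹ ⟦ 3 ⟧) 0≤α)

  overlap-bound : ∀ {Δ c a b ε t} → ε ≤ 1ℚ → Δ + c ≤ a + b → ε * b ≤ c → b ≤ t * a →
                  Δ ≤ (1ℚ + (1ℚ - ε) * t) * a
  overlap-bound {Δ} {c} {a} {b} {ε} {t} ε≤1 Δ+c≤a+b εb≤c b≤ta = begin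
    Δ                        ≡⟨ solve 3 (λ Δ ε b → Δ := (Δ :+ ε :* b) :- ε :* b) refl Δ ε b ⟩
    (Δ + ε * b) - ε * b      ≤⟨ +-monoˡ-≤ (- (ε * b)) (≤-trans (+-monoʳ-≤ Δ εb≤c) Δ+c≤a+b) ⟩
    (a + b) - ε * b          ≡⟨ solve 3 (λ a b ε → (a :+ b) :- ε :* b := a :+ (con 1ℚ :- ε) :* b) refl a b ε ⟩
    a + (1ℚ - ε) * b         ≤⟨ +-monoʳ-≤ a (*-monoˡ-≤-nonNeg (1ℚ - ε) {{nonNegative (p≤q⇒0≤q-p ε≤1)}} b≤ta) ⟩
    a + (1ℚ - ε) * (t * a)   ≡⟨ solve 3 (λ a ε t → a :+ (con 1ℚ :- ε) :* (t :* a)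
                                   := (con 1ℚ :+ (con 1ℚ :- ε) :* t) :* a) refl a ε t ⟩
    (1ℚ + (1ℚ - ε) * t) * a  ∎
    where open ≤-Reasoning

  εb<c≤b⇒ε≤1 : ∀ {ε b c} → 0ℚ ≤ b → c ≤ b → ε * b < c → ε ≤ 1ℚ
  εb<c≤b⇒ε≤1 {ε} {b} {c} 0≤b c≤b εb<c = ≮⇒≥ λ 1<ε →
    <-irrefl refl (<-≤-trans εb<c (≤-trans c≤b (subst (_≤ ε * b) (*-identityˡ b)
      (*-monoʳ-≤-nonNeg b {{nonNegative 0≤b}} (<⇒≤ 1<ε)))))

module Thresholds where
  open import Defs using (LeastOrEnd)
  open import Data.Bool using (true; _∧_)
  open import Data.Bool.Properties using (T-≡; T-∧)
  open import Data.Nat using (_≤_; _<_; _≤ᵇ_; _<ᵇ_)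
  open import Data.Nat.Properties using (≤ᵇ⇒≤; <ᵇ⇒<; ≤-<-trans)
  open import Data.Fin using (Fin; toℕ; fromℕ<) renaming (_≤_ to _≤ᶠ_)
  open import Data.Fin.Properties using (toℕ-fromℕ<; toℕ<n)
  open import Data.Product using (_×_; _,_)
  open import Function using (Equivalence)
  open import Relation.Binary.PropositionalEquality using (_≡_; refl; sym; subst)

  ∧≡true : ∀ {x y} → x ∧ y ≡ true → x ≡ true × y ≡ true
  ∧≡true {true} {true} _ = refl , refl

  window⇒≤×< : ∀ {s t m} → (s ≤ᵇ m) ∧ (m <ᵇ t) ≡ true → s ≤ m × m < t
  window⇒≤×< {s} {t} {m} h with Equivalence.to T-∧ (Equivalence.from T-≡ h)
  ... | s≤ᵇm , m<ᵇt = ≤ᵇ⇒≤ s m s≤ᵇm , <ᵇ⇒< m t m<ᵇt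

  LeastOrEnd-upward : ∀ {n} {P : Fin n → Set} {k} → (∀ {i j} → i ≤ᶠ j → P i → P j) →
                      LeastOrEnd n P k → ∀ i → k ≤ toℕ i → P i
  LeastOrEnd-upward {k = k} upward (_ , _ , P-at-k) i k≤i =
    upward i₀≤i (P-at-k i₀ (toℕ-fromℕ< k<n))
    where
    k<n = ≤-<-trans k≤i (toℕ<n i)
    i₀ = fromℕ< k<n
    i₀≤i : i₀ ≤ᶠ i
    i₀≤i = subst (_≤ toℕ i) (sym (toℕ-fromℕ< k<n)) k≤i

open import Defs
open import Data.Bool using (Bool; true; _∧_)
open import Data.Nat using (ℕ; NonZero; _≤ᵇ_; _<ᵇ_)
open import Data.Integer using (+_)
open import Data.Fin using (Fin; toℕ)
open import Data.Fin.Subset using (Subset; _∩_; ∣_∣)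
open import Data.List using (List)
open import Data.Rational using (ℚ; 0ℚ; 1ℚ; _+_; _-_; _*_; _/_; _<_; _≤_)
open import Relation.Binary.PropositionalEquality using (_≡_)

open import Data.Fin.Subset.Properties using (p⊆q⇒∣p∣≤∣q∣; p∩q⊆q)
open import Data.Product using (proj₁; proj₂)
open import Data.Rational using (>-nonZero)
open import Data.Rational.Properties using (<-≤-trans; ≮⇒≥; <⇒≤; nonNegative⁻¹; normalize-nonNeg)
open import Relation.Binary.PropositionalEquality using (cong; sym; subst₂)
open Ulam using (∣notIn∣≡Δ; Δ+∣notIn∩notIn∣≤∣notIn∣+∣notIn∣)
open RationalBounds
  using (<ᵠ⇒<; ⟦⟧-homo-+; ⟦⟧-mono-≤; ⟦⟧-nonNeg; sumOver-≤-scaled; p*[q÷p]≡q; 2-ε[1+t-q]≡1+[1-ε][1+t];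
         band-ratio; overlap-bound; εb<c≤b⇒ε≤1)
open Thresholds using (∧≡true; window⇒≤×<; LeastOrEnd-upward)

lemma10 : {d n : ℕ} .{{_ : NonZero n}}
  -- S = {x_1,…,x_n} ⊆ Π^d, a set (distinct elements)
  (x : Fin n → Perm d) →
  ((i j : Fin n) → word (x i) ≡ word (x j) → i ≡ j) →
  -- x* is an optimal Ulam 1-median of S
  (x* : Perm d) →
  ((y : Perm d) → sumOver (λ _ → true) (λ i → Δ (x i) x*) Data.Nat.≤ sumOver (λ _ → true) (λ i → Δ (x i) y)) →
  -- fixed longest common subsequences L_i of x_i and x*
  (L : Fin n → List (Fin d)) →
  ((i : Fin n) → IsLCS (L i) (x i) x*) →
  -- |I_1| ≤ … ≤ |I_n|
  ((i j : Fin n) → i Data.Fin.≤ j → ∣ notIn (L i) ∣ Data.Nat.≤ ∣ notIn (L j) ∣) →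
  (α c₃ ε : ℚ) →
  0ℚ < α → α ≤ + 1 / 3 →
  0ℚ < c₃ → c₃ ≤ 1ℚ →
  (ε>0 : 0ℚ < ε) →
  (s t : ℕ) →
  LeastOrEnd n (λ i → (1ℚ - α) * (+ sumOver (λ _ → true) (λ k → Δ (x k) x*) / n) < ⟦ ∣ notIn (L i) ∣ ⟧) s →
  LeastOrEnd n (λ i → (1ℚ + α) * (+ sumOver (λ _ → true) (λ k → Δ (x k) x*) / n) < ⟦ ∣ notIn (L i) ∣ ⟧) t →
  let I : Fin n → Subset d
      I i = notIn (L i)
      F̄ : Fin n → Bool
      F̄ i = (s ≤ᵇ toℕ i) ∧ (toℕ i <ᵇ t)
      B : Fin n → Fin n → Bool
      B j i = F̄ i ∧ ((ε * ⟦ ∣ I j ∣ ⟧) <ᵠ ⟦ ∣ I i ∩ I j ∣ ⟧)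
      OPT_ : (Fin n → Bool) → ℕ
      OPT_ A = sumOver A (λ i → Δ (x i) x*)
  in (j : Fin n) → F̄ j ≡ true →
     c₃ * ⟦ OPT_ F̄ ⟧ ≤ ⟦ OPT_ (B j) ⟧ →
     ⟦ sumOver (B j) (λ i → Δ (x i) (x j)) ⟧
       ≤ (⟦ 2 ⟧ - ε * (1ℚ + ⟦ 3 ⟧ * α - divPos (⟦ 3 ⟧ * α) ε ε>0)) * ⟦ OPT_ (B j) ⟧
lemma10 {d} {n} x _ x* _ L lcs-L mono α _ ε α>0 α≤⅓ _ _ ε>0 s t s-least t-least j j∈F̄ _ =
  sumOver-≤-scaled K B _ _ pointwise
  where
  I : Fin n → Subset d
  I i = notIn (L i)
  F̄ : Fin n → Bool
  F̄ i = (s ≤ᵇ toℕ i) ∧ (toℕ i <ᵇ t)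
  B : Fin n → Bool
  B i = F̄ i ∧ ((ε * ⟦ ∣ I j ∣ ⟧) <ᵠ ⟦ ∣ I i ∩ I j ∣ ⟧)
  K : ℚ
  K = ⟦ 2 ⟧ - ε * (1ℚ + ⟦ 3 ⟧ * α - divPos (⟦ 3 ⟧ * α) ε ε>0)
  K≡ : K ≡ 1ℚ + (1ℚ - ε) * (1ℚ + ⟦ 3 ⟧ * α)
  K≡ = 2-ε[1+t-q]≡1+[1-ε][1+t] ε _ (⟦ 3 ⟧ * α) (p*[q÷p]≡q ε (⟦ 3 ⟧ * α) {{>-nonZero ε>0}})
  OPT : ℕ
  OPT = sumOver (λ _ → true) (λ k → Δ (x k) x*)
  M : ℚ
  M = + OPT / n
  lower : ∀ i → s Data.Nat.≤ toℕ i → (1ℚ - α) * M < ⟦ ∣ I i ∣ ⟧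
  lower = LeastOrEnd-upward (λ i≤j Pi → <-≤-trans Pi (⟦⟧-mono-≤ (mono _ _ i≤j))) s-least
  upper : ∀ i → toℕ i Data.Nat.< t → ⟦ ∣ I i ∣ ⟧ ≤ (1ℚ + α) * M
  upper i i<t = ≮⇒≥ (proj₁ (proj₂ t-least) i i<t)
  pointwise : ∀ i → B i ≡ true → ⟦ Δ (x i) (x j) ⟧ ≤ K * ⟦ Δ (x i) x* ⟧
  pointwise i i∈B =
    subst₂ (λ K′ D → ⟦ Δ (x i) (x j) ⟧ ≤ K′ * D) (sym K≡)
      (cong ⟦_⟧ (∣notIn∣≡Δ {L = L i} {x = x i} {y = x*} (lcs-L i)))
      (overlap-bound ε≤1 pair (<⇒≤ overlapping) ∣Iⱼ∣≤[1+3α]∣Iᵢ∣)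
    where
    overlapping : ε * ⟦ ∣ I j ∣ ⟧ < ⟦ ∣ I i ∩ I j ∣ ⟧
    overlapping = <ᵠ⇒< (proj₂ (∧≡true i∈B))
    ε≤1 : ε ≤ 1ℚ
    ε≤1 = εb<c≤b⇒ε≤1 (⟦⟧-nonNeg ∣ I j ∣) (⟦⟧-mono-≤ (p⊆q⇒∣p∣≤∣q∣ (p∩q⊆q (I i) (I j)))) overlapping
    pair : ⟦ Δ (x i) (x j) ⟧ + ⟦ ∣ I i ∩ I j ∣ ⟧ ≤ ⟦ ∣ I i ∣ ⟧ + ⟦ ∣ I j ∣ ⟧
    pair = subst₂ _≤_ (⟦⟧-homo-+ (Δ (x i) (x j)) ∣ I i ∩ I j ∣) (⟦⟧-homo-+ ∣ I i ∣ ∣ I j ∣)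
             (⟦⟧-mono-≤ (Δ+∣notIn∩notIn∣≤∣notIn∣+∣notIn∣ {Li = L i} {xi = x i} {xj = x j} {z = x*}
                                                             (lcs-L i) (lcs-L j)))
    ∣Iⱼ∣≤[1+3α]∣Iᵢ∣ : ⟦ ∣ I j ∣ ⟧ ≤ (1ℚ + ⟦ 3 ⟧ * α) * ⟦ ∣ I i ∣ ⟧
    ∣Iⱼ∣≤[1+3α]∣Iᵢ∣ = band-ratio (<⇒≤ α>0) α≤⅓ (nonNegative⁻¹ M {{normalize-nonNeg OPT n}})
      (<⇒≤ (lower i (proj₁ (window⇒≤×< {s} {t} (proj₁ (∧≡true i∈B))))))
      (upper j (proj₂ (window⇒≤×< {s} {t} j∈F̄)))
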